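{- Every finite triangle-free graph $G=(V,E)$ satisfies $\operatorname{mic}(G)\ge\frac14\sum_{v\in V}\lg(d(v))$.
   Context: $\lg$ is the base-2 logarithm. $\operatorname{mic}(G)$ is the maximum of $\sum_{v\in I}d_G(v)$ over all independent sets $I$ of $G$. -}

module Defs where

open import Data.Nat using (ℕ; zero; suc; _+_; _*_; _⊔_)
open import Data.Bool using (Bool; true; false; if_then_else_; _∧_; not; T)
open import Data.Fin using (Fin)
open import Data.Fin.Subset using (Subset)
open import Data.List using (List; []; _∷_; map; foldr; allFin; _++_; filter)
open import Data.Nat.ListAction using (sum)
open import Data.Vec using (Vec; []; _∷_; lookup)
open import Data.Product using (_×_)
open import Relation.Binary.PropositionalEquality using (_≡_)
open import Relation.Nullary using (¬_)

record Graph (n : ℕ) : Set where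
  field
    adj    : Fin n → Fin n → Bool
    sym    : ∀ u v → adj u v ≡ adj v u
    irrefl : ∀ v → adj v v ≡ false
open Graph public

TriangleFree : ∀ {n} → Graph n → Set
TriangleFree {n} G =
  ∀ (u v w : Fin n) → ¬ (T (adj G u v) × T (adj G v w) × T (adj G u w))

𝟙 : Bool → ℕ
𝟙 b = if b then 1 else 0

deg : ∀ {n} → Graph n → Fin n → ℕ
deg {n} G v = sum (map (λ u → 𝟙 (adj G v u)) (allFin n))

allSubsets : ∀ n → List (Subset n)
allSubsets zero = [] ∷ []
allSubsets (suc n) =
  map (true ∷_) (allSubsets n) ++ map (false ∷_) (allSubsets n)

independent? : ∀ {n} → Graph n → Subset n → Bool
independent? {n} G I =
  foldr _∧_ true
    (map (λ u → foldr _∧_ true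
       (map (λ v → not (lookup I u ∧ lookup I v ∧ adj G u v)) (allFin n)))
     (allFin n))

degSum : ∀ {n} → Graph n → Subset n → ℕ
degSum {n} G I = sum (map (λ v → if lookup I v then deg G v else 0) (allFin n))

mic : ∀ {n} → Graph n → ℕ
mic {n} G = foldr _⊔_ 0 (map (degSum G) (filter (λ I → T? (independent? G I)) (allSubsets n)))
  where
  open import Relation.Nullary.Decidable using (Dec; yes; no)
  open import Data.Bool.Properties using (T?)

-- Let i be the number of independent sets of G and charge each independent set I at each
-- vertex v by X_v(I) = d(v) [v ∈ I] + |N(v) ∩ I|.  Summed over v this is 2 Σ_{u ∈ I} d(u), which
-- is at most 2 mic(G).  It therefore suffices that d(v)^i ≤ 4^(Σ_I X_v(I)) for every v: this is
-- the paper's bound E[X_v] ≥ lg d(v) / 2 for a uniformly random independent set, with the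
-- denominator cleared.  Multiplying over v gives (Π_v d(v))^i ≤ 4^(2 mic(G) i); take i-th roots.
--
-- For the bound at v, group the independent sets I by B = I minus the closed neighbourhood of v.
-- The group of an independent B consists of B ∪ {v}, with X_v = d, and of the sets B ∪ A for
-- all A ⊆ Y, the neighbours of v without a neighbour in B, with X_v = |A|; triangle-freeness
-- makes each such A independent.  So the group has 1 + 2^y members and total charge
-- d + y 2^(y-1), and d^(1 + 2^y) ≤ 4^(d + y 2^(y-1)) because d ≤ 2^d and d^t ≤ 2^d t^t.

module Submission where

open import Defs hiding (sym)
open import Data.Nat using (ℕ; zero; suc; _+_; _*_; _^_; _<_; _≤_; _⊔_; NonZero; z<s; z≤n; >-nonZero)
open import Data.List using (List; []; _∷_; foldr; map; allFin)
open import Data.Nat.ListAction using (sum; product)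

open import Algebra.Properties.CommutativeSemigroup using (interchange)
open import Data.Bool using (Bool; true; false; T; not; _∧_; if_then_else_)
open import Data.Bool.Properties using (¬-not; T-≡; T-∧; ∧-identityʳ; ∧-zeroʳ)
open import Data.Empty using (⊥-elim)
open import Data.Fin using (Fin; zero; suc)
open import Data.Fin.Subset
  using (Subset; inside; outside; _∈_; _∉_; _⊆_; _∪_; _∩_; ⊥; ⊤; ⁅_⁆; ∁; ∣_∣; Empty)
open import Data.Fin.Subset.Properties
  using ( in⊆in; out⊆; drop-∷-⊆; drop-there; drop-∷-Empty; ⊆-refl; ⊆-antisym; ⊥⊆; ∉⊥
        ; x∈p∪q⁻; x∈p∪q⁺; q⊆p∪q; x∈p∩q⁺; x∈p∩q⁻; x∈∁p⇒x∉p; p∪∁p≡⊤; x∈⁅x⁆; x∈⁅y⁆⇒x≡y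
        ; ∪-identityˡ; ∪-identityʳ; Empty-unique; ∣⊥∣≡0; nonempty? )
import Data.List as List
open import Data.List.Properties using (map-tabulate)
open import Data.List.Membership.Propositional using () renaming (_∈_ to _∈ₗ_)
open import Data.List.Membership.Propositional.Properties
  using (∈-allFin; ∈-map⁺; ∈-++⁺ˡ; ∈-++⁺ʳ; ∈-filter⁺)
open import Data.List.Relation.Unary.Any using (here; there)
import Data.List.Relation.Unary.All as All
open import Data.List.Relation.Unary.All.Properties using (all⁺; all⁻; tabulate⁺)
open import Data.Nat.DivMod using (_/_; _%_; m≡m%n+[m/n]*n; m%n≤n; m/n*n≤m)
open import Data.Nat.Properties
open import Algebra.Properties.Semiring.Sum +-*-semiring
  using (sum-syntax; ∑-comm; ∑-distrib-+; sum-cong-≗; sum-replicate-zero)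
open import Data.Nat.Tactic.RingSolver using (solve-∀)
open import Data.Product using (_,_; _×_; proj₁; proj₂)
open import Data.Sum using (inj₁; inj₂)
open import Data.Vec using ([]; _∷_; lookup; tabulate; here; there)
open import Data.Vec.Properties using (lookup∘tabulate; lookup-zipWith; []=⇒lookup)
open import Function using (_∘_; _∘′_; id)
open import Function.Bundles using (Equivalence; mk⇔; _⇔_)
open import Relation.Binary.PropositionalEquality
open import Relation.Nullary using (¬_)
open import Relation.Nullary.Decidable
  using (does-⇔; T?; isNo; fromWitnessFalse; toWitnessFalse; decidable-stable)

open ≤-Reasoning

^-distribʳ-* : ∀ m n o → (n * o) ^ m ≡ n ^ m * o ^ m
^-distribʳ-* zero    n o = refl
^-distribʳ-* (suc m) n o = begin-equality
  n * o * (n * o) ^ m      ≡⟨ cong (n * o *_) (^-distribʳ-* m n o) ⟩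
  n * o * (n ^ m * o ^ m)  ≡⟨ interchange *-commutativeSemigroup n o (n ^ m) (o ^ m) ⟩
  n * n ^ m * (o * o ^ m)  ∎

n<2^n : ∀ n → n < 2 ^ n
n<2^n zero    = z<s
n<2^n (suc n) = +-mono-≤ (m^n>0 2 n) (≤-trans (n<2^n n) (m≤m+n (2 ^ n) 0))

-- Write m = r + q n with r < n: then m ≤ (1 + q) n ≤ 2 ^ q n and q n ≤ m.
m^n≤2^m*n^n : ∀ m n .{{_ : NonZero n}} → m ^ n ≤ 2 ^ m * n ^ n
m^n≤2^m*n^n m n = begin
  m ^ n                ≤⟨ ^-monoˡ-≤ n m≤2^q*n ⟩
  (2 ^ q * n) ^ n      ≡⟨ ^-distribʳ-* n (2 ^ q) n ⟩
  (2 ^ q) ^ n * n ^ n  ≡⟨ cong (_* n ^ n) (^-*-assoc 2 q n) ⟩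
  2 ^ (q * n) * n ^ n  ≤⟨ *-monoˡ-≤ (n ^ n) (^-monoʳ-≤ 2 (m/n*n≤m m n)) ⟩
  2 ^ m * n ^ n        ∎
  where
  q = m / n
  m≤2^q*n : m ≤ 2 ^ q * n
  m≤2^q*n = begin
    m              ≡⟨ m≡m%n+[m/n]*n m n ⟩
    m % n + q * n  ≤⟨ +-monoˡ-≤ (q * n) (m%n≤n m n) ⟩
    suc q * n      ≤⟨ *-monoˡ-≤ n (n<2^n q) ⟩
    2 ^ q * n      ∎

d^[1+2^y]≤4^[d+s] : ∀ d y s → 2 * s ≡ y * 2 ^ y → d ^ (1 + 2 ^ y) ≤ 4 ^ (d + s)
d^[1+2^y]≤4^[d+s] d y s 2s≡y2^y = begin
  d * d ^ t                    ≤⟨ *-mono-≤ (<⇒≤ (n<2^n d)) (m^n≤2^m*n^n d t {{m^n≢0 2 y}}) ⟩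
  2 ^ d * (2 ^ d * t ^ t)      ≡⟨ cong (λ e → 2 ^ d * (2 ^ d * e)) t^t≡2^[2s] ⟩
  2 ^ d * (2 ^ d * 2 ^ (2 * s)) ≡⟨ cong (2 ^ d *_) (^-distribˡ-+-* 2 d (2 * s)) ⟨
  2 ^ d * 2 ^ (d + 2 * s)      ≡⟨ ^-distribˡ-+-* 2 d (d + 2 * s) ⟨
  2 ^ (d + (d + 2 * s))        ≡⟨ cong (2 ^_) (d+[d+2s]≡2[d+s] d s) ⟩
  2 ^ (2 * (d + s))            ≡⟨ ^-*-assoc 2 2 (d + s) ⟨
  4 ^ (d + s)                  ∎
  where
  t = 2 ^ y
  d+[d+2s]≡2[d+s] : ∀ d s → d + (d + 2 * s) ≡ 2 * (d + s)
  d+[d+2s]≡2[d+s] = solve-∀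
  t^t≡2^[2s] : t ^ t ≡ 2 ^ (2 * s)
  t^t≡2^[2s] = trans (^-*-assoc 2 y t) (cong (2 ^_) (sym 2s≡y2^y))

^-cancelʳ-≤ : ∀ k .{{_ : NonZero k}} {m n} → m ^ k ≤ n ^ k → m ≤ n
^-cancelʳ-≤ k m^k≤n^k = ≮⇒≥ (λ n<m → <⇒≱ (^-monoˡ-< k n<m) m^k≤n^k)

[m⊔1]^k≤b^e : ∀ m k b e .{{_ : NonZero b}} → m ^ k ≤ b ^ e → (m ⊔ 1) ^ k ≤ b ^ e
[m⊔1]^k≤b^e zero    k b e _       = ≤-trans (≤-reflexive (^-zeroˡ k)) (m^n>0 b e)
[m⊔1]^k≤b^e (suc m) k b e m^k≤b^e = subst (λ x → suc x ^ k ≤ b ^ e) (sym (⊔-identityʳ m)) m^k≤b^e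

product-^-≤ : ∀ {A : Set} (f g : A → ℕ) {k b} (xs : List A) → (∀ x → f x ^ k ≤ b ^ g x) →
              product (map f xs) ^ k ≤ b ^ sum (map g xs)
product-^-≤ f g {k} []       _ = ≤-reflexive (^-zeroˡ k)
product-^-≤ f g {k} {b} (x ∷ xs) le = begin
  (f x * product (map f xs)) ^ k         ≡⟨ ^-distribʳ-* k (f x) _ ⟩
  f x ^ k * product (map f xs) ^ k       ≤⟨ *-mono-≤ (le x) (product-^-≤ f g {k} xs le) ⟩
  b ^ g x * b ^ sum (map g xs)           ≡⟨ ^-distribˡ-+-* b (g x) _ ⟨
  b ^ (g x + sum (map g xs))             ∎

-- Sums over the subsets of a subset

∑⊆ : ∀ {n} → Subset n → (Subset n → ℕ) → ℕ
∑⊆ []            f = f []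
∑⊆ (inside ∷ M)  f = ∑⊆ M (f ∘ (inside ∷_)) + ∑⊆ M (f ∘ (outside ∷_))
∑⊆ (outside ∷ M) f = ∑⊆ M (f ∘ (outside ∷_))

infixl 10 ∑⊆
syntax ∑⊆ M (λ A → e) = ∑[ A ⊆ M ] e

∑⊆-preserves : ∀ (R : ℕ → ℕ → Set) → (∀ {x y u w} → R x y → R u w → R (x + u) (y + w)) →
               ∀ {n} (M : Subset n) {f g} → (∀ {A} → A ⊆ M → R (f A) (g A)) → R (∑⊆ M f) (∑⊆ M g)
∑⊆-preserves R +-pres []            R-fg = R-fg ⊆-refl
∑⊆-preserves R +-pres (inside ∷ M)  R-fg =
  +-pres (∑⊆-preserves R +-pres M (R-fg ∘′ in⊆in)) (∑⊆-preserves R +-pres M (R-fg ∘′ out⊆))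
∑⊆-preserves R +-pres (outside ∷ M) R-fg = ∑⊆-preserves R +-pres M (R-fg ∘′ out⊆)

∑⊆-cong : ∀ {n} (M : Subset n) {f g} → (∀ {A} → A ⊆ M → f A ≡ g A) → ∑⊆ M f ≡ ∑⊆ M g
∑⊆-cong = ∑⊆-preserves _≡_ (cong₂ _+_)

∑⊆-mono-≤ : ∀ {n} (M : Subset n) {f g} → (∀ {A} → A ⊆ M → f A ≤ g A) → ∑⊆ M f ≤ ∑⊆ M g
∑⊆-mono-≤ = ∑⊆-preserves _≤_ +-mono-≤

∑⊆-^-≤ : ∀ {n} (M : Subset n) {a b c s} → (∀ {A} → A ⊆ M → a ^ c A ≤ b ^ s A) →
         a ^ ∑⊆ M c ≤ b ^ ∑⊆ M s
∑⊆-^-≤ M {a} {b} =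
  ∑⊆-preserves (λ x y → a ^ x ≤ b ^ y) (λ {x} {y} {u} {w} → ^-+-≤ {x} {y} {u} {w}) M
  where
  ^-+-≤ : ∀ {x y u w} → a ^ x ≤ b ^ y → a ^ u ≤ b ^ w → a ^ (x + u) ≤ b ^ (y + w)
  ^-+-≤ {x} {y} {u} {w} a^x≤b^y a^u≤b^w = begin
    a ^ (x + u)    ≡⟨ ^-distribˡ-+-* a x u ⟩
    a ^ x * a ^ u  ≤⟨ *-mono-≤ a^x≤b^y a^u≤b^w ⟩
    b ^ y * b ^ w  ≡⟨ ^-distribˡ-+-* b y w ⟨
    b ^ (y + w)    ∎

∑⊆-zero : ∀ {n} (M : Subset n) {f} → (∀ {A} → A ⊆ M → f A ≡ 0) → ∑⊆ M f ≡ 0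
∑⊆-zero []            f≡0 = f≡0 ⊆-refl
∑⊆-zero (inside ∷ M)  f≡0 = cong₂ _+_ (∑⊆-zero M (f≡0 ∘′ in⊆in)) (∑⊆-zero M (f≡0 ∘′ out⊆))
∑⊆-zero (outside ∷ M) f≡0 = ∑⊆-zero M (f≡0 ∘′ out⊆)

∑⊆-distrib-+ : ∀ {n} (M : Subset n) f g → ∑⊆ M (λ A → f A + g A) ≡ ∑⊆ M f + ∑⊆ M g
∑⊆-distrib-+ []            f g = refl
∑⊆-distrib-+ (inside ∷ M)  f g = trans
  (cong₂ _+_ (∑⊆-distrib-+ M (f ∘ (inside ∷_)) (g ∘ (inside ∷_)))
             (∑⊆-distrib-+ M (f ∘ (outside ∷_)) (g ∘ (outside ∷_))))
  (interchange +-commutativeSemigroup (∑⊆ M (f ∘ (inside ∷_))) _ _ _)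
∑⊆-distrib-+ (outside ∷ M) f g = ∑⊆-distrib-+ M (f ∘ (outside ∷_)) (g ∘ (outside ∷_))

∑⊆-*ˡ : ∀ {n} (M : Subset n) k f → ∑⊆ M (λ A → k * f A) ≡ k * ∑⊆ M f
∑⊆-*ˡ []            k f = refl
∑⊆-*ˡ (inside ∷ M)  k f =
  trans (cong₂ _+_ (∑⊆-*ˡ M k (f ∘ (inside ∷_))) (∑⊆-*ˡ M k (f ∘ (outside ∷_))))
        (sym (*-distribˡ-+ k _ _))
∑⊆-*ˡ (outside ∷ M) k f = ∑⊆-*ˡ M k (f ∘ (outside ∷_))

∑⊆-⊥ : ∀ {n} f → ∑⊆ (⊥ {n}) f ≡ f ⊥
∑⊆-⊥ {zero}  f = refl
∑⊆-⊥ {suc n} f = ∑⊆-⊥ (f ∘ (outside ∷_))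

∑⊆-⁅⁆ : ∀ {n} (x : Fin n) f → ∑⊆ ⁅ x ⁆ f ≡ f ⁅ x ⁆ + f ⊥
∑⊆-⁅⁆ zero    f = cong₂ _+_ (∑⊆-⊥ (f ∘ (inside ∷_))) (∑⊆-⊥ (f ∘ (outside ∷_)))
∑⊆-⁅⁆ (suc x) f = ∑⊆-⁅⁆ x (f ∘ (outside ∷_))

f⊥≤∑⊆ : ∀ {n} (M : Subset n) f → f ⊥ ≤ ∑⊆ M f
f⊥≤∑⊆ []            f = ≤-refl
f⊥≤∑⊆ (inside ∷ M)  f = ≤-trans (f⊥≤∑⊆ M (f ∘ (outside ∷_))) (m≤n+m _ _)
f⊥≤∑⊆ (outside ∷ M) f = f⊥≤∑⊆ M (f ∘ (outside ∷_))

∑⊆-∪ : ∀ {n} (T U : Subset n) f → Empty (T ∩ U) →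
       ∑⊆ (T ∪ U) f ≡ ∑[ B ⊆ U ] ∑[ A ⊆ T ] f (A ∪ B)
∑⊆-∪ []            []            f _ = refl
∑⊆-∪ (inside ∷ T)  (inside ∷ U)  f T∩U≡∅ = ⊥-elim (T∩U≡∅ (zero , here))
∑⊆-∪ (inside ∷ T)  (outside ∷ U) f T∩U≡∅ = begin-equality
  ∑⊆ (T ∪ U) (f ∘ (inside ∷_)) + ∑⊆ (T ∪ U) (f ∘ (outside ∷_))
    ≡⟨ cong₂ _+_ (∑⊆-∪ T U (f ∘ (inside ∷_)) T∩U≡∅′) (∑⊆-∪ T U (f ∘ (outside ∷_)) T∩U≡∅′) ⟩
  ∑[ B ⊆ U ] ∑[ A ⊆ T ] f (inside ∷ A ∪ B) + ∑[ B ⊆ U ] ∑[ A ⊆ T ] f (outside ∷ A ∪ B)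
    ≡⟨ ∑⊆-distrib-+ U _ _ ⟨
  ∑[ B ⊆ U ] (∑[ A ⊆ T ] f (inside ∷ A ∪ B) + ∑[ A ⊆ T ] f (outside ∷ A ∪ B)) ∎
  where T∩U≡∅′ = drop-∷-Empty T∩U≡∅
∑⊆-∪ (outside ∷ T) (inside ∷ U)  f T∩U≡∅ =
  cong₂ _+_ (∑⊆-∪ T U (f ∘ (inside ∷_)) T∩U≡∅′) (∑⊆-∪ T U (f ∘ (outside ∷_)) T∩U≡∅′)
  where T∩U≡∅′ = drop-∷-Empty T∩U≡∅
∑⊆-∪ (outside ∷ T) (outside ∷ U) f T∩U≡∅ = ∑⊆-∪ T U (f ∘ (outside ∷_)) (drop-∷-Empty T∩U≡∅)

∑⊆-restrict : ∀ {n} {M M′ : Subset n} f → M′ ⊆ M →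
              (∀ {A x} → A ⊆ M → x ∈ A → x ∉ M′ → f A ≡ 0) → ∑⊆ M f ≡ ∑⊆ M′ f
∑⊆-restrict {M = []}           {[]}           f _ _ = refl
∑⊆-restrict {M = inside ∷ M}   {inside ∷ M′}  f M′⊆M f≡0 = cong₂ _+_
  (∑⊆-restrict (f ∘ (inside ∷_)) (drop-∷-⊆ M′⊆M)
     λ A⊆M x∈A x∉M′ → f≡0 (in⊆in A⊆M) (there x∈A) (x∉M′ ∘ drop-there))
  (∑⊆-restrict (f ∘ (outside ∷_)) (drop-∷-⊆ M′⊆M)
     λ A⊆M x∈A x∉M′ → f≡0 (out⊆ A⊆M) (there x∈A) (x∉M′ ∘ drop-there))
∑⊆-restrict {M = inside ∷ M}   {outside ∷ M′} f M′⊆M f≡0 = cong₂ _+_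
  (∑⊆-zero M λ A⊆M → f≡0 (in⊆in A⊆M) here λ ())
  (∑⊆-restrict (f ∘ (outside ∷_)) (drop-∷-⊆ M′⊆M)
     λ A⊆M x∈A x∉M′ → f≡0 (out⊆ A⊆M) (there x∈A) (x∉M′ ∘ drop-there))
∑⊆-restrict {M = outside ∷ M}  {inside ∷ M′}  f M′⊆M _ with M′⊆M here
... | ()
∑⊆-restrict {M = outside ∷ M}  {outside ∷ M′} f M′⊆M f≡0 =
  ∑⊆-restrict (f ∘ (outside ∷_)) (drop-∷-⊆ M′⊆M)
    λ A⊆M x∈A x∉M′ → f≡0 (out⊆ A⊆M) (there x∈A) (x∉M′ ∘ drop-there)

∑⊆-1 : ∀ {n} (M : Subset n) → ∑[ A ⊆ M ] 1 ≡ 2 ^ ∣ M ∣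
∑⊆-1 []            = refl
∑⊆-1 (inside ∷ M)  = trans (cong₂ _+_ (∑⊆-1 M) (∑⊆-1 M)) (cong (2 ^ ∣ M ∣ +_) (sym (+-identityʳ _)))
∑⊆-1 (outside ∷ M) = ∑⊆-1 M

2*∑⊆∣∣ : ∀ {n} (M : Subset n) → 2 * ∑[ A ⊆ M ] ∣ A ∣ ≡ ∣ M ∣ * 2 ^ ∣ M ∣
2*∑⊆∣∣ []            = refl
2*∑⊆∣∣ (inside ∷ M)  = begin-equality
  2 * (∑[ A ⊆ M ] (1 + ∣ A ∣) + s)  ≡⟨ cong (λ x → 2 * (x + s)) (∑⊆-distrib-+ M (λ _ → 1) ∣_∣) ⟩
  2 * (∑[ A ⊆ M ] 1 + s + s)        ≡⟨ cong (λ x → 2 * (x + s + s)) (∑⊆-1 M) ⟩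
  2 * (2 ^ m + s + s)              ≡⟨ expand (2 ^ m) s ⟩
  2 * 2 ^ m + 2 * s + 2 * s        ≡⟨ cong (λ x → 2 * 2 ^ m + x + x) (2*∑⊆∣∣ M) ⟩
  2 * 2 ^ m + m * 2 ^ m + m * 2 ^ m ≡⟨ collect m (2 ^ m) ⟩
  suc m * (2 * 2 ^ m)              ∎
  where
  m = ∣ M ∣
  s = ∑[ A ⊆ M ] ∣ A ∣
  expand : ∀ p s → 2 * (p + s + s) ≡ 2 * p + 2 * s + 2 * s
  expand = solve-∀
  collect : ∀ m p → 2 * p + m * p + m * p ≡ suc m * (2 * p)
  collect = solve-∀
2*∑⊆∣∣ (outside ∷ M) = 2*∑⊆∣∣ M

∑⊆-∑-comm : ∀ {m n} (M : Subset n) (f : Fin m → Subset n → ℕ) →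
            ∑[ A ⊆ M ] ∑[ i < m ] f i A ≡ ∑[ i < m ] ∑⊆ M (f i)
∑⊆-∑-comm {zero}  M f = ∑⊆-zero M (λ _ → refl)
∑⊆-∑-comm {suc m} M f =
  trans (∑⊆-distrib-+ M (f zero) _) (cong (∑⊆ M (f zero) +_) (∑⊆-∑-comm M (f ∘ suc)))

-- Independent sets and charges

sum-map-allFin : ∀ {n} (f : Fin n → ℕ) → sum (map f (allFin n)) ≡ ∑[ i < n ] f i
sum-map-allFin {n} f = trans (cong sum (map-tabulate id f)) (sum-tabulate n f)
  where
  sum-tabulate : ∀ n (f : Fin n → ℕ) → sum (List.tabulate f) ≡ ∑[ i < n ] f i
  sum-tabulate zero    f = refl
  sum-tabulate (suc n) f = cong (f zero +_) (sum-tabulate n (f ∘ suc))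

∣p∣≡∑𝟙 : ∀ {n} (p : Subset n) → ∣ p ∣ ≡ ∑[ i < n ] 𝟙 (lookup p i)
∣p∣≡∑𝟙 []            = refl
∣p∣≡∑𝟙 (inside ∷ p)  = cong suc (∣p∣≡∑𝟙 p)
∣p∣≡∑𝟙 (outside ∷ p) = ∣p∣≡∑𝟙 p

∈⇒T-lookup : ∀ {n} {p : Subset n} {x} → x ∈ p → T (lookup p x)
∈⇒T-lookup here        = _
∈⇒T-lookup (there x∈p) = ∈⇒T-lookup x∈p

T-lookup⇒∈ : ∀ {n} (p : Subset n) x → T (lookup p x) → x ∈ p
T-lookup⇒∈ (inside ∷ p) zero    _ = here
T-lookup⇒∈ (_ ∷ p)      (suc x) t = there (T-lookup⇒∈ p x t)

∉⇒lookup≡outside : ∀ {n} {p : Subset n} {x} → x ∉ p → lookup p x ≡ outside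
∉⇒lookup≡outside {p = p} {x} x∉p = ¬-not (x∉p ∘ T-lookup⇒∈ p x ∘ Equivalence.from T-≡)

∈-tabulate⁺ : ∀ {n} {f : Fin n → Bool} {x} → T (f x) → x ∈ tabulate f
∈-tabulate⁺ {f = f} {x} t = T-lookup⇒∈ (tabulate f) x (subst T (sym (lookup∘tabulate f x)) t)

∈-tabulate⁻ : ∀ {n} {f : Fin n → Bool} {x} → x ∈ tabulate f → T (f x)
∈-tabulate⁻ {f = f} {x} x∈ = subst T (lookup∘tabulate f x) (∈⇒T-lookup x∈)

T-all-allFin : ∀ {n} (p : Fin n → Bool) → T (foldr _∧_ true (map p (allFin n))) ⇔ (∀ i → T (p i))
T-all-allFin {n} p = mk⇔
  (λ t i → All.lookup (all⁺ p (allFin n) t) (∈-allFin i))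
  (λ h → all⁻ p (tabulate⁺ h))

T-nand : ∀ {a b c} → T (not (a ∧ b ∧ c)) ⇔ (T a → T b → ¬ T c)
T-nand {true}  {true}  {true}  = mk⇔ (λ ()) (λ h → h _ _ _)
T-nand {true}  {true}  {false} = mk⇔ (λ _ _ _ ()) _
T-nand {true}  {false}         = mk⇔ (λ _ _ ()) _
T-nand {false}                 = mk⇔ (λ _ ()) _

Independent : ∀ {n} → Graph n → Subset n → Set
Independent G I = ∀ {u w} → u ∈ I → w ∈ I → ¬ T (adj G u w)

T-independent? : ∀ {n} (G : Graph n) (I : Subset n) → T (independent? G I) ⇔ Independent G I
T-independent? G I = mk⇔
  (λ t {u} {w} u∈I w∈I → Equivalence.to T-nand (pair-ok t u w) (∈⇒T-lookup u∈I) (∈⇒T-lookup w∈I))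
  (λ ind → Equivalence.from (T-all-allFin _) λ u → Equivalence.from (T-all-allFin _) λ w →
     Equivalence.from T-nand λ tu tw → ind (T-lookup⇒∈ I u tu) (T-lookup⇒∈ I w tw))
  where
  pair-ok : T (independent? G I) → ∀ u w → T (not (lookup I u ∧ lookup I w ∧ adj G u w))
  pair-ok t u w = Equivalence.to (T-all-allFin _) (Equivalence.to (T-all-allFin _) t u) w

independent-⊆ : ∀ {n} (G : Graph n) {I J} → I ⊆ J → Independent G J → Independent G I
independent-⊆ G I⊆J indJ u∈I w∈I = indJ (I⊆J u∈I) (I⊆J w∈I)

independent-∪ : ∀ {n} (G : Graph n) {I J} → Independent G I → Independent G J →
                (∀ {u w} → u ∈ I → w ∈ J → ¬ T (adj G u w)) → Independent G (I ∪ J)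
independent-∪ G {I} {J} indI indJ I-J {u} {w} u∈ w∈ with x∈p∪q⁻ I J u∈ | x∈p∪q⁻ I J w∈
... | inj₁ u∈I | inj₁ w∈I = indI u∈I w∈I
... | inj₁ u∈I | inj₂ w∈J = I-J u∈I w∈J
... | inj₂ u∈J | inj₁ w∈I = I-J w∈I u∈J ∘ subst T (Graph.sym G u w)
... | inj₂ u∈J | inj₂ w∈J = indJ u∈J w∈J

independent?-∪ : ∀ {n} (G : Graph n) {S B} → Independent G S →
                 (∀ {u w} → u ∈ S → w ∈ B → ¬ T (adj G u w)) →
                 independent? G (S ∪ B) ≡ independent? G B
independent?-∪ G {S} {B} indS S-B = does-⇔ (mk⇔
  (λ t → from (independent-⊆ G (q⊆p∪q S B) (to t)))
  (λ t → from (independent-∪ G indS (to t) S-B)))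
  (T? _) (T? _)
  where
  to   = λ {I} → Equivalence.to (T-independent? G I)
  from = λ {I} → Equivalence.from (T-independent? G I)

independent?-edge : ∀ {n} (G : Graph n) {I u w} → u ∈ I → w ∈ I → T (adj G u w) →
                    independent? G I ≡ false
independent?-edge G {I} u∈I w∈I uw =
  ¬-not λ ind≡true → Equivalence.to (T-independent? G I) (Equivalence.from T-≡ ind≡true) u∈I w∈I uw

∑indep : ∀ {n} → Graph n → (Subset n → ℕ) → ℕ
∑indep G f = ∑[ I ⊆ ⊤ ] (if independent? G I then f I else 0)

VanishesOnEdges : ∀ {n} → Graph n → (Subset n → ℕ) → Set
VanishesOnEdges G h = ∀ {W u w} → u ∈ W → w ∈ W → T (adj G u w) → h W ≡ 0

neighbours : ∀ {n} → Graph n → Fin n → Subset n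
neighbours G v = tabulate (adj G v)

-- Each u ∈ W sends d(u) to itself and 1 to each neighbour; v receives charge G v W.
charge : ∀ {n} → Graph n → Fin n → Subset n → ℕ
charge G v W = (if lookup W v then deg G v else 0) + ∣ neighbours G v ∩ W ∣

∑-charge : ∀ {n} (G : Graph n) W → ∑[ v < n ] charge G v W ≡ 2 * degSum G W
∑-charge {n} G W = begin-equality
  ∑[ v < n ] charge G v W
    ≡⟨ ∑-distrib-+ (λ v → if lookup W v then deg G v else 0) _ ⟩
  ∑[ v < n ] (if lookup W v then deg G v else 0) + ∑[ v < n ] ∣ neighbours G v ∩ W ∣
    ≡⟨ cong₂ _+_ (sym (sum-map-allFin (λ v → if lookup W v then deg G v else 0))) received ⟩
  degSum G W + degSum G W
    ≡⟨ cong (degSum G W +_) (+-identityʳ _) ⟨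
  2 * degSum G W ∎
  where
  column : ∀ u → ∑[ v < n ] 𝟙 (adj G v u ∧ lookup W u) ≡ (if lookup W u then deg G u else 0)
  column u with lookup W u
  ... | true  = trans (sum-cong-≗ λ v → cong 𝟙 (trans (∧-identityʳ _) (Graph.sym G v u)))
                      (sym (sum-map-allFin (λ w → 𝟙 (adj G u w))))
  ... | false = trans (sum-cong-≗ λ v → cong 𝟙 (∧-zeroʳ (adj G v u))) (sum-replicate-zero n)
  received : ∑[ v < n ] ∣ neighbours G v ∩ W ∣ ≡ degSum G W
  received = begin-equality
    ∑[ v < n ] ∣ neighbours G v ∩ W ∣
      ≡⟨ sum-cong-≗ (λ v → trans (∣p∣≡∑𝟙 (neighbours G v ∩ W)) (sum-cong-≗ λ u →
           cong 𝟙 (trans (lookup-zipWith _∧_ u (neighbours G v) W)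
                         (cong (_∧ lookup W u) (lookup∘tabulate (adj G v) u))))) ⟩
    ∑[ v < n ] ∑[ u < n ] 𝟙 (adj G v u ∧ lookup W u)
      ≡⟨ ∑-comm (λ v u → 𝟙 (adj G v u ∧ lookup W u)) ⟩
    ∑[ u < n ] ∑[ v < n ] 𝟙 (adj G v u ∧ lookup W u)
      ≡⟨ sum-cong-≗ column ⟩
    ∑[ u < n ] (if lookup W u then deg G u else 0)
      ≡⟨ sum-map-allFin (λ u → if lookup W u then deg G u else 0) ⟨
    degSum G W ∎

-- Grouping the independent sets around a vertex

module _ {n} (G : Graph n) (v : Fin n) where

  private
    N = neighbours G v

  far : Subset n
  far = ∁ (N ∪ ⁅ v ⁆)

  free : Subset n → Subset n
  free B = tabulate (λ u → adj G v u ∧ isNo (nonempty? (neighbours G u ∩ B)))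

  ∈-far⁻ : ∀ {u} → u ∈ far → ¬ T (adj G v u) × u ≢ v
  ∈-far⁻ {u} u∈far = (λ vu → u∉ (x∈p∪q⁺ (inj₁ (∈-tabulate⁺ vu))))
                   , (λ { refl → u∉ (x∈p∪q⁺ (inj₂ (x∈⁅x⁆ v))) })
    where u∉ = x∈∁p⇒x∉p u∈far

  ∈-free⁺ : ∀ {B u} → T (adj G v u) → Empty (neighbours G u ∩ B) → u ∈ free B
  ∈-free⁺ vu isolated = ∈-tabulate⁺ (Equivalence.from T-∧ (vu , fromWitnessFalse isolated))

  ∈-free⁻ : ∀ {B u} → u ∈ free B → T (adj G v u) × Empty (neighbours G u ∩ B)
  ∈-free⁻ u∈free = let vu , isolated = Equivalence.to T-∧ (∈-tabulate⁻ u∈free)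
                   in vu , toWitnessFalse isolated

  free⊆neighbours : ∀ {B} → free B ⊆ N
  free⊆neighbours = ∈-tabulate⁺ ∘ proj₁ ∘ ∈-free⁻

  adj-irrefl : ¬ T (adj G v v)
  adj-irrefl = subst T (irrefl G v)

  ⁅v⁆-independent : Independent G ⁅ v ⁆
  ⁅v⁆-independent u∈ w∈ with x∈⁅y⁆⇒x≡y v u∈ | x∈⁅y⁆⇒x≡y v w∈
  ... | refl | refl = adj-irrefl

  ⁅v⁆-far-nonadjacent : ∀ {B u w} → B ⊆ far → u ∈ ⁅ v ⁆ → w ∈ B → ¬ T (adj G u w)
  ⁅v⁆-far-nonadjacent B⊆far u∈ w∈B with x∈⁅y⁆⇒x≡y v u∈
  ... | refl = proj₁ (∈-far⁻ (B⊆far w∈B))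

  free-independent : TriangleFree G → ∀ B → Independent G (free B)
  free-independent tf B u∈ w∈ uw = tf v _ _ (proj₁ (∈-free⁻ u∈) , uw , proj₁ (∈-free⁻ w∈))

  free-nonadjacent : ∀ {B u w} → u ∈ free B → w ∈ B → ¬ T (adj G u w)
  free-nonadjacent u∈ w∈B uw = proj₂ (∈-free⁻ u∈) (_ , x∈p∩q⁺ (∈-tabulate⁺ uw , w∈B))

  ∑⊆⊤-around : ∀ h → ∑⊆ ⊤ h ≡
    ∑[ B ⊆ far ] (∑[ A ⊆ N ] h ((A ∪ ⁅ v ⁆) ∪ B) + ∑[ A ⊆ N ] h ((A ∪ ⊥) ∪ B))
  ∑⊆⊤-around h = begin-equality
    ∑⊆ ⊤ h
      ≡⟨ cong (λ M → ∑⊆ M h) (p∪∁p≡⊤ (N ∪ ⁅ v ⁆)) ⟨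
    ∑⊆ ((N ∪ ⁅ v ⁆) ∪ far) h
      ≡⟨ ∑⊆-∪ (N ∪ ⁅ v ⁆) far h C∩∁C≡∅ ⟩
    ∑[ B ⊆ far ] ∑[ S ⊆ N ∪ ⁅ v ⁆ ] h (S ∪ B)
      ≡⟨ ∑⊆-cong far (λ _ → trans (∑⊆-∪ N ⁅ v ⁆ _ N∩⁅v⁆≡∅) (∑⊆-⁅⁆ v _)) ⟩
    ∑[ B ⊆ far ] (∑[ A ⊆ N ] h ((A ∪ ⁅ v ⁆) ∪ B) + ∑[ A ⊆ N ] h ((A ∪ ⊥) ∪ B)) ∎
    where
    C∩∁C≡∅ : Empty ((N ∪ ⁅ v ⁆) ∩ far)
    C∩∁C≡∅ (_ , x∈) = let x∈C , x∈∁C = x∈p∩q⁻ _ _ x∈ in x∈∁p⇒x∉p x∈∁C x∈C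
    N∩⁅v⁆≡∅ : Empty (N ∩ ⁅ v ⁆)
    N∩⁅v⁆≡∅ (_ , x∈) with x∈p∩q⁻ N _ x∈
    ... | x∈N , x∈⁅v⁆ with x∈⁅y⁆⇒x≡y v x∈⁅v⁆
    ... | refl = adj-irrefl (∈-tabulate⁻ x∈N)

  module _ {h} (h-vanishes : VanishesOnEdges G h) where

    ∑⊆-with-v : ∀ B → ∑[ A ⊆ N ] h ((A ∪ ⁅ v ⁆) ∪ B) ≡ h (⁅ v ⁆ ∪ B)
    ∑⊆-with-v B = begin-equality
      ∑[ A ⊆ N ] h ((A ∪ ⁅ v ⁆) ∪ B)
        ≡⟨ ∑⊆-restrict _ ⊥⊆ (λ A⊆N x∈A _ → h-vanishes (∈A x∈A) ∈v (vx A⊆N x∈A)) ⟩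
      ∑[ A ⊆ ⊥ ] h ((A ∪ ⁅ v ⁆) ∪ B)  ≡⟨ ∑⊆-⊥ (λ A → h ((A ∪ ⁅ v ⁆) ∪ B)) ⟩
      h ((⊥ ∪ ⁅ v ⁆) ∪ B)             ≡⟨ cong (λ S → h (S ∪ B)) (∪-identityˡ ⁅ v ⁆) ⟩
      h (⁅ v ⁆ ∪ B)                   ∎
      where
      ∈A : ∀ {A x} → x ∈ A → x ∈ (A ∪ ⁅ v ⁆) ∪ B
      ∈A x∈A = x∈p∪q⁺ (inj₁ (x∈p∪q⁺ (inj₁ x∈A)))
      ∈v : ∀ {A} → v ∈ (A ∪ ⁅ v ⁆) ∪ B
      ∈v = x∈p∪q⁺ (inj₁ (x∈p∪q⁺ (inj₂ (x∈⁅x⁆ v))))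
      vx : ∀ {A x} → A ⊆ N → x ∈ A → T (adj G x v)
      vx {x = x} A⊆N x∈A = subst T (Graph.sym G v x) (∈-tabulate⁻ (A⊆N x∈A))

    ∑⊆-without-v : ∀ B → ∑[ A ⊆ N ] h ((A ∪ ⊥) ∪ B) ≡ ∑[ A ⊆ free B ] h (A ∪ B)
    ∑⊆-without-v B = trans
      (∑⊆-cong N (λ _ → cong (λ S → h (S ∪ B)) (∪-identityʳ _)))
      (∑⊆-restrict _ free⊆neighbours vanish)
      where
      vanish : ∀ {A x} → A ⊆ N → x ∈ A → x ∉ free B → h (A ∪ B) ≡ 0
      vanish A⊆N x∈A x∉free
        with decidable-stable (nonempty? _) (x∉free ∘ ∈-free⁺ (∈-tabulate⁻ (A⊆N x∈A)))
      ... | w , w∈ with x∈p∩q⁻ _ B w∈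
      ... | w∈Nx , w∈B = h-vanishes (x∈p∪q⁺ (inj₁ x∈A)) (x∈p∪q⁺ (inj₂ w∈B)) (∈-tabulate⁻ w∈Nx)

    ∑⊆⊤-vanishing-around : ∑⊆ ⊤ h ≡ ∑[ B ⊆ far ] (h (⁅ v ⁆ ∪ B) + ∑[ A ⊆ free B ] h (A ∪ B))
    ∑⊆⊤-vanishing-around =
      trans (∑⊆⊤-around h) (∑⊆-cong far λ {B} _ → cong₂ _+_ (∑⊆-with-v B) (∑⊆-without-v B))

  ∑indep-around : TriangleFree G → ∀ f → ∑indep G f ≡
    ∑[ B ⊆ far ] (if independent? G B then f (⁅ v ⁆ ∪ B) + ∑[ A ⊆ free B ] f (A ∪ B) else 0)
  ∑indep-around tf f = trans (∑⊆⊤-vanishing-around vanishes) (∑⊆-cong far block)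
    where
    h : Subset n → ℕ
    h I = if independent? G I then f I else 0
    vanishes : VanishesOnEdges G h
    vanishes {W} u∈ w∈ uw = cong (λ b → if b then f W else 0) (independent?-edge G u∈ w∈ uw)
    if-+-∑⊆ : ∀ b x (M : Subset n) g → (if b then x else 0) + ∑[ A ⊆ M ] (if b then g A else 0) ≡
                                        (if b then x + ∑⊆ M g else 0)
    if-+-∑⊆ true  x M g = refl
    if-+-∑⊆ false x M g = ∑⊆-zero M (λ _ → refl)
    block : ∀ {B} → B ⊆ far → h (⁅ v ⁆ ∪ B) + ∑[ A ⊆ free B ] h (A ∪ B) ≡
            (if independent? G B then f (⁅ v ⁆ ∪ B) + ∑[ A ⊆ free B ] f (A ∪ B) else 0)
    block {B} B⊆far = begin-equality
      h (⁅ v ⁆ ∪ B) + ∑[ A ⊆ free B ] h (A ∪ B)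
        ≡⟨ cong₂ _+_
             (cong (λ b → if b then f (⁅ v ⁆ ∪ B) else 0)
                   (independent?-∪ G ⁅v⁆-independent (⁅v⁆-far-nonadjacent B⊆far)))
             (∑⊆-cong (free B) λ {A} A⊆free → cong (λ b → if b then f (A ∪ B) else 0)
                   (independent?-∪ G (independent-⊆ G A⊆free (free-independent tf B))
                                     (free-nonadjacent ∘′ A⊆free))) ⟩
      (if independent? G B then f (⁅ v ⁆ ∪ B) else 0) +
        ∑[ A ⊆ free B ] (if independent? G B then f (A ∪ B) else 0)
        ≡⟨ if-+-∑⊆ (independent? G B) _ (free B) (λ A → f (A ∪ B)) ⟩
      (if independent? G B then f (⁅ v ⁆ ∪ B) + ∑[ A ⊆ free B ] f (A ∪ B) else 0) ∎

  charge-⁅v⁆∪ : ∀ {B} → B ⊆ far → charge G v (⁅ v ⁆ ∪ B) ≡ deg G v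
  charge-⁅v⁆∪ {B} B⊆far = begin-equality
    charge G v (⁅ v ⁆ ∪ B)
      ≡⟨ cong₂ _+_ (cong (λ b → if b then deg G v else 0) v∈) (cong ∣_∣ (Empty-unique N∩≡∅)) ⟩
    deg G v + ∣ ⊥ {n = n} ∣  ≡⟨ cong (deg G v +_) (∣⊥∣≡0 n) ⟩
    deg G v + 0              ≡⟨ +-identityʳ _ ⟩
    deg G v                  ∎
    where
    v∈ : lookup (⁅ v ⁆ ∪ B) v ≡ inside
    v∈ = []=⇒lookup (x∈p∪q⁺ (inj₁ (x∈⁅x⁆ v)))
    N∩≡∅ : Empty (N ∩ (⁅ v ⁆ ∪ B))
    N∩≡∅ (x , x∈) with x∈p∩q⁻ N _ x∈
    ... | x∈N , x∈⁅v⁆∪B with x∈p∪q⁻ ⁅ v ⁆ B x∈⁅v⁆∪B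
    ... | inj₁ x∈⁅v⁆ rewrite x∈⁅y⁆⇒x≡y v x∈⁅v⁆ = adj-irrefl (∈-tabulate⁻ x∈N)
    ... | inj₂ x∈B = proj₁ (∈-far⁻ (B⊆far x∈B)) (∈-tabulate⁻ x∈N)

  charge-∪ : ∀ {A B} → A ⊆ N → B ⊆ far → charge G v (A ∪ B) ≡ ∣ A ∣
  charge-∪ {A} {B} A⊆N B⊆far =
    cong₂ _+_ (cong (λ b → if b then deg G v else 0) (∉⇒lookup≡outside v∉A∪B)) (cong ∣_∣ N∩[A∪B]≡A)
    where
    v∉A∪B : v ∉ A ∪ B
    v∉A∪B v∈ with x∈p∪q⁻ A B v∈
    ... | inj₁ v∈A = adj-irrefl (∈-tabulate⁻ (A⊆N v∈A))
    ... | inj₂ v∈B = proj₂ (∈-far⁻ (B⊆far v∈B)) refl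
    N∩[A∪B]⊆A : N ∩ (A ∪ B) ⊆ A
    N∩[A∪B]⊆A x∈ with x∈p∩q⁻ N _ x∈
    ... | x∈N , x∈A∪B with x∈p∪q⁻ A B x∈A∪B
    ... | inj₁ x∈A = x∈A
    ... | inj₂ x∈B = ⊥-elim (proj₁ (∈-far⁻ (B⊆far x∈B)) (∈-tabulate⁻ x∈N))
    N∩[A∪B]≡A : N ∩ (A ∪ B) ≡ A
    N∩[A∪B]≡A = ⊆-antisym N∩[A∪B]⊆A (λ x∈A → x∈p∩q⁺ (A⊆N x∈A , x∈p∪q⁺ (inj₁ x∈A)))

  deg^∑indep1≤4^∑indep-charge :
    TriangleFree G → deg G v ^ ∑indep G (λ _ → 1) ≤ 4 ^ ∑indep G (charge G v)
  deg^∑indep1≤4^∑indep-charge tf = subst₂ (λ c s → deg G v ^ c ≤ 4 ^ s)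
    (sym (∑indep-around tf (λ _ → 1))) (sym (∑indep-around tf (charge G v))) (∑⊆-^-≤ far block)
    where
    block : ∀ {B} → B ⊆ far →
      deg G v ^ (if independent? G B then 1 + ∑[ A ⊆ free B ] 1 else 0) ≤
      4 ^ (if independent? G B
             then charge G v (⁅ v ⁆ ∪ B) + ∑[ A ⊆ free B ] charge G v (A ∪ B) else 0)
    block {B} B⊆far with independent? G B
    ... | false = ≤-refl
    ... | true  = subst₂ (λ c s → deg G v ^ c ≤ 4 ^ s)
      (cong suc (sym (∑⊆-1 Y)))
      (sym (cong₂ _+_ (charge-⁅v⁆∪ B⊆far)
                      (∑⊆-cong Y λ A⊆Y → charge-∪ (free⊆neighbours ∘′ A⊆Y) B⊆far)))
      (d^[1+2^y]≤4^[d+s] (deg G v) ∣ Y ∣ _ (2*∑⊆∣∣ Y))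
      where Y = free B

-- Comparison with mic

∈-allSubsets : ∀ {n} (I : Subset n) → I ∈ₗ allSubsets n
∈-allSubsets []            = here refl
∈-allSubsets (inside ∷ I)  = ∈-++⁺ˡ (∈-map⁺ (inside ∷_) (∈-allSubsets I))
∈-allSubsets (outside ∷ I) =
  ∈-++⁺ʳ (map (inside ∷_) (allSubsets _)) (∈-map⁺ (outside ∷_) (∈-allSubsets I))

≤-foldr-⊔ : ∀ {m xs} → m ∈ₗ xs → m ≤ foldr _⊔_ 0 xs
≤-foldr-⊔ (here refl)                 = m≤m⊔n _ _
≤-foldr-⊔ {xs = x ∷ _} (there m∈xs) = ≤-trans (≤-foldr-⊔ m∈xs) (m≤n⊔m x _)

degSum≤mic : ∀ {n} (G : Graph n) {I} → T (independent? G I) → degSum G I ≤ mic G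
degSum≤mic G {I} ind =
  ≤-foldr-⊔ (∈-map⁺ (degSum G) (∈-filter⁺ (λ I → T? (independent? G I)) (∈-allSubsets I) ind))

∑-∑indep-charge≤ : ∀ {n} (G : Graph n) →
                   ∑[ v < n ] ∑indep G (charge G v) ≤ 2 * mic G * ∑indep G (λ _ → 1)
∑-∑indep-charge≤ {n} G = begin
  ∑[ v < n ] ∑indep G (charge G v)
    ≡⟨ ∑⊆-∑-comm (⊤ {n}) (λ v I → if independent? G I then charge G v I else 0) ⟨
  ∑[ I ⊆ ⊤ ] ∑[ v < n ] (if independent? G I then charge G v I else 0)
    ≤⟨ ∑⊆-mono-≤ ⊤ (λ {I} _ → pointwise I) ⟩
  ∑[ I ⊆ ⊤ ] (2 * mic G * (if independent? G I then 1 else 0))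
    ≡⟨ ∑⊆-*ˡ ⊤ (2 * mic G) (λ I → if independent? G I then 1 else 0) ⟩
  2 * mic G * ∑indep G (λ _ → 1) ∎
  where
  pointwise : ∀ I → ∑[ v < n ] (if independent? G I then charge G v I else 0) ≤
                    2 * mic G * (if independent? G I then 1 else 0)
  pointwise I with independent? G I in ind
  ... | true  = begin
    ∑[ v < n ] charge G v I  ≡⟨ ∑-charge G I ⟩
    2 * degSum G I          ≤⟨ *-monoʳ-≤ 2 (degSum≤mic G {I} (subst T (sym ind) _)) ⟩
    2 * mic G               ≡⟨ *-identityʳ (2 * mic G) ⟨
    2 * mic G * 1           ∎
  ... | false = ≤-trans (≤-reflexive (sum-replicate-zero n)) z≤n

∑indep-1>0 : ∀ {n} (G : Graph n) → 0 < ∑indep G (λ _ → 1)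
∑indep-1>0 G = ≤-trans (≤-reflexive (cong (λ b → if b then 1 else 0) (sym ⊥-independent)))
                       (f⊥≤∑⊆ ⊤ (λ I → if independent? G I then 1 else 0))
  where
  ⊥-independent : independent? G ⊥ ≡ true
  ⊥-independent =
    Equivalence.to T-≡ (Equivalence.from (T-independent? G ⊥) (λ u∈⊥ → ⊥-elim (∉⊥ u∈⊥)))

lemma5p1 : ∀ (n : ℕ) (G : Graph n) → TriangleFree G →
    product (map (λ v → deg G v ⊔ 1) (allFin n)) ≤ 2 ^ (4 * mic G)
lemma5p1 n G tf = ^-cancelʳ-≤ i {{>-nonZero (∑indep-1>0 G)}} (begin
  product (map (λ v → deg G v ⊔ 1) (allFin n)) ^ i
    ≤⟨ product-^-≤ (λ v → deg G v ⊔ 1) X {i} (allFin n)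
         (λ v → [m⊔1]^k≤b^e (deg G v) i 4 (X v) (deg^∑indep1≤4^∑indep-charge G v tf)) ⟩
  4 ^ sum (map X (allFin n))  ≡⟨ cong (4 ^_) (sum-map-allFin X) ⟩
  4 ^ ∑[ v < n ] X v          ≤⟨ ^-monoʳ-≤ 4 (∑-∑indep-charge≤ G) ⟩
  4 ^ (2 * mic G * i)         ≡⟨ ^-*-assoc 2 2 (2 * mic G * i) ⟩
  2 ^ (2 * (2 * mic G * i))   ≡⟨ cong (2 ^_) (2[2mi]≡4mi (mic G) i) ⟩
  2 ^ (4 * mic G * i)         ≡⟨ ^-*-assoc 2 (4 * mic G) i ⟨
  (2 ^ (4 * mic G)) ^ i       ∎)
  where
  i = ∑indep G (λ _ → 1)
  X = λ v → ∑indep G (charge G v)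
  2[2mi]≡4mi : ∀ m i → 2 * (2 * m * i) ≡ 4 * m * i
  2[2mi]≡4mi = solve-∀
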